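{- Let $\lambda=(\lambda_1\ge\lambda_2\ge\cdots\ge\lambda_\alpha)$ be a partition with all $\lambda_i\ge 1$, let $W_1,\dots,W_\alpha$ be pairwise disjoint sets with $|W_i|=\lambda_i$, and let $\Gamma_\lambda=2^{W_1}\cup\cdots\cup 2^{W_\alpha}$ (so each $2^{W_i}$ is a $(\lambda_i-1)$-simplex and $\dim\Gamma_\lambda=\lambda_1-1$). Write $L=\lambda_1$ and let $\mu=(\mu_1,\dots,\mu_L)$ be the conjugate partition, $\mu_m=\#\{j:\lambda_j\ge m\}$ for $1\le m\le L$. Then the $h$-vector of $\Gamma_\lambda$ satisfies $h_0=1$ and, for all $1\le k\le L$, $$(-1)^{k-1}h_k=\sum_{m=1}^{L-k+1}\binom{L-m}{k-1}(\mu_m-1).$$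
   Context: A simplicial complex is a nonempty family of subsets of a set closed under taking subsets; faces have dimension $|S|-1$. A $d$-simplex is $2^W$ for a set $W$ with $d+1$ elements. For a complex $\Gamma$ of dimension $d$, its $f$-vector is $(f_{ -1},f_0,\dots,f_d)$ with $f_k$ the number of $k$-dimensional faces (so $f_{ -1}=1$), and its $h$-vector is $(h_0,\dots,h_{d+1})$ with $$h_k=\sum_{i=0}^{k}(-1)^{k-i}\binom{d+1-i}{d+1-k}f_{i-1}.$$ -}

module Defs where

open import Data.Nat as ℕ using (ℕ; zero; suc; _≤_; _≤?_; _∸_)
open import Data.Nat.Combinatorics using (_C_)
open import Data.Integer as ℤ using (ℤ; +_; _-_; _*_; _+_; -_)
open import Data.Fin using (Fin)
open import Data.Fin.Subset using (Subset; ∣_∣; _⊆_; inside; outside)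
open import Data.Fin.Subset.Properties using (_⊆?_)
open import Data.Fin.Properties using (any?)
open import Data.List using (List; []; _∷_; map; _++_; filter; length; allFin)
open import Data.Vec using (_∷_; [])
open import Data.Product using (∃)
open import Relation.Nullary.Decidable using (_×-dec_)
open import Relation.Unary using (Pred; Decidable)
open import Level using (0ℓ)

Σℤ : ℕ → (ℕ → ℤ) → ℤ
Σℤ zero    f = + 0
Σℤ (suc n) f = Σℤ n f + f n

sgn : ℕ → ℤ
sgn zero    = + 1
sgn (suc k) = - sgn k

allSubsets : (n : ℕ) → List (Subset n)
allSubsets zero    = [] ∷ []
allSubsets (suc n) = map (outside ∷_) (allSubsets n) ++ map (inside ∷_) (allSubsets n)

-- A simplicial complex on the vertex set Fin n, given by a decidable
-- membership predicate on subsets (closure under subsets is assumed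
-- separately where needed).
-- Number of faces with exactly i elements (i.e. f_{i-1}).
fCount : {n : ℕ} (Γ : Pred (Subset n) 0ℓ) → Decidable Γ → ℕ → ℕ
fCount {n} Γ Γ? i = length (filter (λ S → (∣ S ∣ ℕ.≟ i) ×-dec Γ? S) (allSubsets n))

-- h-vector of a (d)-dimensional complex, written with D = d + 1:
-- h_k = Σ_{i=0}^{k} (-1)^{k-i} C(D - i, D - k) f_{i-1}
hVec : {n : ℕ} (Γ : Pred (Subset n) 0ℓ) → Decidable Γ → (D : ℕ) → ℕ → ℤ
hVec Γ Γ? D k =
  Σℤ (suc k) (λ i → sgn (k ∸ i) * (+ ((D ∸ i) C (D ∸ k))) * + (fCount Γ Γ? i))

unionOfSimplices : {n α : ℕ} → (Fin α → Subset n) → Pred (Subset n) 0ℓ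
unionOfSimplices W S = ∃ λ i → S ⊆ W i

unionOfSimplices? : {n α : ℕ} (W : Fin α → Subset n) → Decidable (unionOfSimplices W)
unionOfSimplices? W S = any? (λ i → S ⊆? W i)

conj : {α : ℕ} → (Fin α → ℕ) → ℕ → ℕ
conj {α} λ' m = length (filter (λ j → m ≤? λ' j) (allFin α))

-- Since the W_j are disjoint, the simplices 2^{W_j} pairwise meet only in the empty face, so
-- f_{i-1}(Γ_λ) = C(0,i) + Σ_j (C(λ_j,i) - C(0,i)).  The h-vector (taken in dimension L - 1) is
-- linear in the f-vector, and for a simplex on λ ≤ L vertices it is h_k = (-1)^k C(L-λ,k), by
-- induction on λ with Pascal's rule.  Hence (-1)^(k-1) h_k = Σ_j (C(L,k) - C(L-λ_j,k)) - C(L,k).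
-- On the other side μ_m = Σ_j [m ≤ λ_j]; the terms with L-k+1 < m ≤ L vanish, so after exchanging
-- the sums the hockey-stick identity Σ_{m=1}^{λ} C(L-m,k-1) = C(L,k) - C(L-λ,k) gives the same.

module Submission where

open import Defs
import Algebra.Properties.Semiring.Sum as SemiringSum
open import Data.Bool using (if_then_else_)
open import Data.Empty using (⊥; ⊥-elim)
open import Data.Fin using (Fin; zero; suc) renaming (_≤_ to _≤ᶠ_)
import Data.Fin.Properties as Fin
open import Data.Fin.Subset using (Subset; ∣_∣; _∈_; _⊆_; _∩_; Empty; Nonempty; inside; outside)
open import Data.Fin.Subset.Properties using (_⊆?_; out⊆; in⊆in; drop-∷-⊆; x∈p∩q⁺)
open import Data.Integer as ℤ using (ℤ; +_; _+_; _-_; _*_; -_)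
import Data.Integer.Properties as ℤ
open import Data.Integer.Tactic.RingSolver using (solve-∀)
open import Data.List using (List; []; _∷_; map; _++_; filter; length; allFin; tabulate)
open import Data.List.Properties using (map-++; map-∘; map-cong)
open import Data.Nat as ℕ using (ℕ; zero; suc; _≤_; _<_; _∸_; z≤n; s≤s; _≤?_)
import Data.Nat.ListAction as List
open import Data.Nat.ListAction.Properties using (sum-++)
import Data.Nat.Properties as ℕ
open import Data.Nat.Combinatorics
  using (_C_; nCk+nC[k+1]≡[n+1]C[k+1]; nCk≡nC[n∸k]; nCn≡1; k>n⇒nCk≡0)
open import Data.Product using (_×_; _,_)
open import Data.Sum using (inj₁; inj₂)
open import Data.Vec using ([]; _∷_; here; there)
open import Function using (_∘_)
open import Level using (0ℓ)
open import Relation.Nullary using (Dec; does; yes; no; ¬_)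
open import Relation.Nullary.Decidable using (_×-dec_)
open import Relation.Unary using (Pred; Decidable)
open import Relation.Binary.PropositionalEquality

module ℕΣ = SemiringSum ℕ.+-*-semiring
open SemiringSum ℤ.+-*-semiring
  using (sum; sum-syntax; sum-cong-≗; sum-replicate-zero; ∑-distrib-+; *-distribˡ-sum)

-- Defined through `does` so that 𝟙 (any? Q?) reduces along the decisions any? is built from.
𝟙 : {P : Set} → Dec P → ℕ
𝟙 p? = if does p? then 1 else 0

𝟙-yes : {P : Set} (p? : Dec P) → P → 𝟙 p? ≡ 1
𝟙-yes (yes _) _ = refl
𝟙-yes (no ¬p) p = ⊥-elim (¬p p)

𝟙-no : {P : Set} (p? : Dec P) → ¬ P → 𝟙 p? ≡ 0
𝟙-no (yes p) ¬p = ⊥-elim (¬p p)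
𝟙-no (no _) _ = refl

𝟙-cong : {P Q : Set} → (P → Q) → (Q → P) → (p? : Dec P) (q? : Dec Q) → 𝟙 p? ≡ 𝟙 q?
𝟙-cong P→Q _ (yes p) q? = sym (𝟙-yes q? (P→Q p))
𝟙-cong _ Q→P (no ¬p) q? = sym (𝟙-no q? (¬p ∘ Q→P))

𝟙-×-dec : {P Q : Set} (p? : Dec P) (q? : Dec Q) → 𝟙 (p? ×-dec q?) ≡ 𝟙 p? ℕ.* 𝟙 q?
𝟙-×-dec (yes _) q? = sym (ℕ.+-identityʳ (𝟙 q?))
𝟙-×-dec (no _) q? = refl

𝟙-*-cong : {P : Set} (p? : Dec P) {x y : ℕ} → (P → x ≡ y) → 𝟙 p? ℕ.* x ≡ 𝟙 p? ℕ.* y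
𝟙-*-cong (yes p) x≡y = cong (1 ℕ.*_) (x≡y p)
𝟙-*-cong (no _) _ = refl

𝟙-any? : ∀ {m} {Q : Fin m → Set} (Q? : ∀ j → Dec (Q j)) → (∀ j k → Q j → Q k → j ≡ k) →
         𝟙 (Fin.any? Q?) ≡ ℕΣ.sum (λ j → 𝟙 (Q? j))
𝟙-any? {zero} Q? _ = refl
𝟙-any? {suc m} Q? unique with Q? zero
... | yes q = cong suc (sym (trans (ℕΣ.sum-cong-≗ others-fail) (ℕΣ.sum-replicate-zero m)))
  where
  others-fail : ∀ j → 𝟙 (Q? (suc j)) ≡ 0
  others-fail j = 𝟙-no (Q? (suc j)) (λ q′ → Fin.0≢1+n (unique zero (suc j) q q′))
... | no _ = 𝟙-any? (Q? ∘ suc) (λ j k q q′ → Fin.suc-injective (unique (suc j) (suc k) q q′))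

length-filter≡sum-𝟙 : {A : Set} {P : Pred A 0ℓ} (P? : Decidable P) (xs : List A) →
                       length (filter P? xs) ≡ List.sum (map (𝟙 ∘ P?) xs)
length-filter≡sum-𝟙 P? [] = refl
length-filter≡sum-𝟙 P? (x ∷ xs) with P? x
... | yes _ = cong suc (length-filter≡sum-𝟙 P? xs)
... | no _ = length-filter≡sum-𝟙 P? xs

sum-map-cong : {A : Set} {v w : A → ℕ} → (∀ x → v x ≡ w x) → (xs : List A) →
               List.sum (map v xs) ≡ List.sum (map w xs)
sum-map-cong v≗w xs = cong List.sum (map-cong v≗w xs)

sum-map-zero : {A : Set} {w : A → ℕ} → (∀ x → w x ≡ 0) → (xs : List A) →
               List.sum (map w xs) ≡ 0
sum-map-zero w≗0 [] = refl
sum-map-zero w≗0 (x ∷ xs) = cong₂ ℕ._+_ (w≗0 x) (sum-map-zero w≗0 xs)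

sum-map-∑ : {A : Set} {m : ℕ} (w : A → Fin m → ℕ) (xs : List A) →
            List.sum (map (λ x → ℕΣ.sum (w x)) xs)
              ≡ ℕΣ.sum (λ j → List.sum (map (λ x → w x j) xs))
sum-map-∑ {m = m} w [] = sym (ℕΣ.sum-replicate-zero m)
sum-map-∑ w (x ∷ xs) =
  trans (cong (ℕΣ.sum (w x) ℕ.+_) (sum-map-∑ w xs)) (sym (ℕΣ.∑-distrib-+ (w x) _))

sum-map-tabulate : ∀ {A : Set} {m} (w : A → ℕ) (f : Fin m → A) →
                   List.sum (map w (tabulate f)) ≡ ℕΣ.sum (w ∘ f)
sum-map-tabulate {m = zero} w f = refl
sum-map-tabulate {m = suc m} w f = cong (w (f zero) ℕ.+_) (sum-map-tabulate w (f ∘ suc))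

sum-map-allSubsets-suc : ∀ n (w : Subset (suc n) → ℕ) →
  List.sum (map w (allSubsets (suc n)))
    ≡ List.sum (map (w ∘ (outside ∷_)) (allSubsets n))
        ℕ.+ List.sum (map (w ∘ (inside ∷_)) (allSubsets n))
sum-map-allSubsets-suc n w = begin
    List.sum (map w (map (outside ∷_) S ++ map (inside ∷_) S))
  ≡⟨ cong List.sum (map-++ w (map (outside ∷_) S) _) ⟩
    List.sum (map w (map (outside ∷_) S) ++ map w (map (inside ∷_) S))
  ≡⟨ sum-++ (map w (map (outside ∷_) S)) _ ⟩
    List.sum (map w (map (outside ∷_) S)) ℕ.+ List.sum (map w (map (inside ∷_) S))
  ≡⟨ sym (cong₂ ℕ._+_ (cong List.sum (map-∘ S)) (cong List.sum (map-∘ S))) ⟩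
    List.sum (map (w ∘ (outside ∷_)) S) ℕ.+ List.sum (map (w ∘ (inside ∷_)) S) ∎
  where
  open ≡-Reasoning
  S = allSubsets n

𝟙-sized-subset : ∀ {n} → ℕ → Subset n → Subset n → ℕ
𝟙-sized-subset i W S = 𝟙 (∣ S ∣ ℕ.≟ i) ℕ.* 𝟙 (S ⊆? W)

𝟙-sized-subset-outside : ∀ {n} i b (W S : Subset n) →
                         𝟙-sized-subset i (b ∷ W) (outside ∷ S) ≡ 𝟙-sized-subset i W S
𝟙-sized-subset-outside i b W S =
  cong (𝟙 (∣ S ∣ ℕ.≟ i) ℕ.*_) (𝟙-cong drop-∷-⊆ out⊆ ((outside ∷ S) ⊆? (b ∷ W)) (S ⊆? W))

sum-𝟙-sized-subset : ∀ {n} (W : Subset n) i →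
                     List.sum (map (𝟙-sized-subset i W) (allSubsets n)) ≡ ∣ W ∣ C i
sum-𝟙-sized-subset [] zero = refl
sum-𝟙-sized-subset [] (suc i) = refl
sum-𝟙-sized-subset {suc n} (outside ∷ W) i = begin
    List.sum (map (𝟙-sized-subset i (outside ∷ W)) (allSubsets (suc n)))
  ≡⟨ sum-map-allSubsets-suc n (𝟙-sized-subset i (outside ∷ W)) ⟩
    List.sum (map (𝟙-sized-subset i (outside ∷ W) ∘ (outside ∷_)) S)
      ℕ.+ List.sum (map (𝟙-sized-subset i (outside ∷ W) ∘ (inside ∷_)) S)
  ≡⟨ cong₂ ℕ._+_ (sum-map-cong (𝟙-sized-subset-outside i outside W) S)
                 (sum-map-zero inside-excluded S) ⟩
    List.sum (map (𝟙-sized-subset i W) S) ℕ.+ 0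
  ≡⟨ ℕ.+-identityʳ _ ⟩
    List.sum (map (𝟙-sized-subset i W) S)
  ≡⟨ sum-𝟙-sized-subset W i ⟩
    ∣ W ∣ C i ∎
  where
  open ≡-Reasoning
  S = allSubsets n
  inside-excluded : ∀ T → 𝟙-sized-subset i (outside ∷ W) (inside ∷ T) ≡ 0
  inside-excluded T = trans
    (cong (𝟙 (suc ∣ T ∣ ℕ.≟ i) ℕ.*_) (𝟙-no ((inside ∷ T) ⊆? (outside ∷ W)) (λ T⊆W → zero∉ (T⊆W here))))
    (ℕ.*-zeroʳ (𝟙 (suc ∣ T ∣ ℕ.≟ i)))
    where
    zero∉ : zero ∈ outside ∷ W → ⊥
    zero∉ ()
sum-𝟙-sized-subset {suc n} (inside ∷ W) i = begin
    List.sum (map (𝟙-sized-subset i (inside ∷ W)) (allSubsets (suc n)))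
  ≡⟨ sum-map-allSubsets-suc n (𝟙-sized-subset i (inside ∷ W)) ⟩
    List.sum (map (𝟙-sized-subset i (inside ∷ W) ∘ (outside ∷_)) S)
      ℕ.+ List.sum (map (𝟙-sized-subset i (inside ∷ W) ∘ (inside ∷_)) S)
  ≡⟨ cong₂ ℕ._+_ (sum-map-cong (𝟙-sized-subset-outside i inside W) S)
                 (sum-map-cong inside-kept S) ⟩
    List.sum (map (𝟙-sized-subset i W) S) ℕ.+ List.sum (map (extended-sized i) S)
  ≡⟨ cong (ℕ._+ List.sum (map (extended-sized i) S)) (sum-𝟙-sized-subset W i) ⟩
    ∣ W ∣ C i ℕ.+ List.sum (map (extended-sized i) S)
  ≡⟨ pascal-step i ⟩
    suc ∣ W ∣ C i ∎
  where
  open ≡-Reasoning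
  S = allSubsets n
  extended-sized : ℕ → Subset n → ℕ
  extended-sized j T = 𝟙 (suc ∣ T ∣ ℕ.≟ j) ℕ.* 𝟙 (T ⊆? W)
  inside-kept : ∀ T → 𝟙-sized-subset i (inside ∷ W) (inside ∷ T) ≡ extended-sized i T
  inside-kept T =
    cong (𝟙 (suc ∣ T ∣ ℕ.≟ i) ℕ.*_) (𝟙-cong drop-∷-⊆ in⊆in ((inside ∷ T) ⊆? (inside ∷ W)) (T ⊆? W))
  pascal-step : ∀ i → ∣ W ∣ C i ℕ.+ List.sum (map (extended-sized i) S) ≡ suc ∣ W ∣ C i
  pascal-step zero =
    cong suc (sum-map-zero (λ T → cong (ℕ._* 𝟙 (T ⊆? W)) (𝟙-no (suc ∣ T ∣ ℕ.≟ 0) λ ())) S)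
  pascal-step (suc i) = begin
      ∣ W ∣ C suc i ℕ.+ List.sum (map (extended-sized (suc i)) S)
    ≡⟨ cong (∣ W ∣ C suc i ℕ.+_) (trans (sum-map-cong size-pred S) (sum-𝟙-sized-subset W i)) ⟩
      ∣ W ∣ C suc i ℕ.+ ∣ W ∣ C i
    ≡⟨ ℕ.+-comm (∣ W ∣ C suc i) _ ⟩
      ∣ W ∣ C i ℕ.+ ∣ W ∣ C suc i
    ≡⟨ nCk+nC[k+1]≡[n+1]C[k+1] ∣ W ∣ i ⟩
      suc ∣ W ∣ C suc i ∎
    where
    size-pred : ∀ T → extended-sized (suc i) T ≡ 𝟙-sized-subset i W T
    size-pred T =
      cong (ℕ._* 𝟙 (T ⊆? W)) (𝟙-cong ℕ.suc-injective (cong suc) (suc ∣ T ∣ ℕ.≟ suc i) (∣ T ∣ ℕ.≟ i))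

PairwiseDisjoint : ∀ {n α} → (Fin α → Subset n) → Set
PairwiseDisjoint W = ∀ i j → i ≢ j → Empty (W i ∩ W j)

fCount≡sum-𝟙 : ∀ {n} (Γ : Pred (Subset n) 0ℓ) (Γ? : Decidable Γ) i →
               fCount Γ Γ? i
                 ≡ List.sum (map (λ S → 𝟙 (∣ S ∣ ℕ.≟ i) ℕ.* 𝟙 (Γ? S)) (allSubsets n))
fCount≡sum-𝟙 {n} Γ Γ? i =
  trans (length-filter≡sum-𝟙 _ (allSubsets n))
        (sum-map-cong (λ S → 𝟙-×-dec (∣ S ∣ ℕ.≟ i) (Γ? S)) (allSubsets n))

∣p∣≡0⇒p⊆q : ∀ {n} {p q : Subset n} → ∣ p ∣ ≡ 0 → p ⊆ q
∣p∣≡0⇒p⊆q {p = outside ∷ p} {_ ∷ q} ∣p∣≡0 (there x∈p) = there (∣p∣≡0⇒p⊆q ∣p∣≡0 x∈p)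

∣p∣≡1+i⇒Nonempty : ∀ {n i} (p : Subset n) → ∣ p ∣ ≡ suc i → Nonempty p
∣p∣≡1+i⇒Nonempty (inside ∷ p) _ = zero , here
∣p∣≡1+i⇒Nonempty (outside ∷ p) ∣p∣≡1+i with ∣p∣≡1+i⇒Nonempty p ∣p∣≡1+i
... | x , x∈p = suc x , there x∈p

fCount-unionOfSimplices-zero : ∀ {n a} (W : Fin (suc a) → Subset n) →
                               fCount (unionOfSimplices W) (unionOfSimplices? W) 0 ≡ 1
fCount-unionOfSimplices-zero {n} W = begin
    fCount (unionOfSimplices W) (unionOfSimplices? W) 0
  ≡⟨ fCount≡sum-𝟙 (unionOfSimplices W) (unionOfSimplices? W) 0 ⟩
    List.sum (map (λ S → 𝟙 (∣ S ∣ ℕ.≟ 0) ℕ.* 𝟙 (unionOfSimplices? W S)) (allSubsets n))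
  ≡⟨ sum-map-cong empty-face (allSubsets n) ⟩
    List.sum (map (𝟙-sized-subset 0 (W zero)) (allSubsets n))
  ≡⟨ sum-𝟙-sized-subset (W zero) 0 ⟩
    ∣ W zero ∣ C 0 ∎
  where
  open ≡-Reasoning
  empty-face : ∀ S → 𝟙 (∣ S ∣ ℕ.≟ 0) ℕ.* 𝟙 (unionOfSimplices? W S)
                     ≡ 𝟙 (∣ S ∣ ℕ.≟ 0) ℕ.* 𝟙 (S ⊆? W zero)
  empty-face S = 𝟙-*-cong (∣ S ∣ ℕ.≟ 0) λ ∣S∣≡0 →
    trans (𝟙-yes (unionOfSimplices? W S) (zero , ∣p∣≡0⇒p⊆q ∣S∣≡0))
          (sym (𝟙-yes (S ⊆? W zero) (∣p∣≡0⇒p⊆q ∣S∣≡0)))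

module _ {n α : ℕ} (W : Fin α → Subset n) (disjoint : PairwiseDisjoint W) where

  nonempty-face-unique : ∀ {S} → Nonempty S → ∀ j k → S ⊆ W j → S ⊆ W k → j ≡ k
  nonempty-face-unique (x , x∈S) j k S⊆Wj S⊆Wk with j Fin.≟ k
  ... | yes j≡k = j≡k
  ... | no j≢k = ⊥-elim (disjoint j k j≢k (x , x∈p∩q⁺ (S⊆Wj x∈S , S⊆Wk x∈S)))

  fCount-unionOfSimplices-suc : ∀ i → fCount (unionOfSimplices W) (unionOfSimplices? W) (suc i)
                                       ≡ ℕΣ.sum (λ j → ∣ W j ∣ C suc i)
  fCount-unionOfSimplices-suc i = begin
      fCount (unionOfSimplices W) (unionOfSimplices? W) (suc i)
    ≡⟨ fCount≡sum-𝟙 (unionOfSimplices W) (unionOfSimplices? W) (suc i) ⟩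
      List.sum (map (λ S → 𝟙 (∣ S ∣ ℕ.≟ suc i) ℕ.* 𝟙 (unionOfSimplices? W S)) (allSubsets n))
    ≡⟨ sum-map-cong face-in-one-simplex (allSubsets n) ⟩
      List.sum (map (λ S → ℕΣ.sum (λ j → 𝟙-sized-subset (suc i) (W j) S)) (allSubsets n))
    ≡⟨ sum-map-∑ (λ S j → 𝟙-sized-subset (suc i) (W j) S) (allSubsets n) ⟩
      ℕΣ.sum (λ j → List.sum (map (𝟙-sized-subset (suc i) (W j)) (allSubsets n)))
    ≡⟨ ℕΣ.sum-cong-≗ (λ j → sum-𝟙-sized-subset (W j) (suc i)) ⟩
      ℕΣ.sum (λ j → ∣ W j ∣ C suc i) ∎
    where
    open ≡-Reasoning
    face-in-one-simplex : ∀ S → 𝟙 (∣ S ∣ ℕ.≟ suc i) ℕ.* 𝟙 (unionOfSimplices? W S)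
                                ≡ ℕΣ.sum (λ j → 𝟙 (∣ S ∣ ℕ.≟ suc i) ℕ.* 𝟙 (S ⊆? W j))
    face-in-one-simplex S = trans
      (𝟙-*-cong (∣ S ∣ ℕ.≟ suc i) λ ∣S∣≡1+i →
        𝟙-any? (λ j → S ⊆? W j) (nonempty-face-unique (∣p∣≡1+i⇒Nonempty S ∣S∣≡1+i)))
      (ℕΣ.*-distribˡ-sum (𝟙 (∣ S ∣ ℕ.≟ suc i)) (λ j → 𝟙 (S ⊆? W j)))

pos-sum : ∀ {m} (f : Fin m → ℕ) → + ℕΣ.sum f ≡ ∑[ j < m ] (+ f j)
pos-sum {zero} f = refl
pos-sum {suc m} f = trans (ℤ.pos-+ (f zero) _) (cong (_+_ (+ f zero)) (pos-sum (f ∘ suc)))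

fCount-unionOfSimplices : ∀ {n a} (W : Fin (suc a) → Subset n) → PairwiseDisjoint W → ∀ i →
  + fCount (unionOfSimplices W) (unionOfSimplices? W) i
    ≡ + (0 C i) + ∑[ j < suc a ] (+ (∣ W j ∣ C i) - + (0 C i))
fCount-unionOfSimplices {a = a} W _ zero =
  trans (cong +_ (fCount-unionOfSimplices-zero W)) (cong (_+_ (+ 1)) (sym (sum-replicate-zero (suc a))))
fCount-unionOfSimplices {a = a} W disjoint (suc i) = begin
    + fCount (unionOfSimplices W) (unionOfSimplices? W) (suc i)
  ≡⟨ cong +_ (fCount-unionOfSimplices-suc W disjoint i) ⟩
    + ℕΣ.sum (λ j → ∣ W j ∣ C suc i)
  ≡⟨ pos-sum (λ j → ∣ W j ∣ C suc i) ⟩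
    ∑[ j < suc a ] (+ (∣ W j ∣ C suc i))
  ≡⟨ sym (trans (ℤ.+-identityˡ _) (sum-cong-≗ λ j → ℤ.+-identityʳ (+ (∣ W j ∣ C suc i)))) ⟩
    + 0 + ∑[ j < suc a ] (+ (∣ W j ∣ C suc i) - + 0) ∎
  where open ≡-Reasoning

Σℤ-cong : ∀ n {f g : ℕ → ℤ} → (∀ i → i < n → f i ≡ g i) → Σℤ n f ≡ Σℤ n g
Σℤ-cong zero _ = refl
Σℤ-cong (suc n) f≡g =
  cong₂ _+_ (Σℤ-cong n (λ i i<n → f≡g i (ℕ.m<n⇒m<1+n i<n))) (f≡g n (ℕ.n<1+n n))

Σℤ-zero : ∀ n → Σℤ n (λ _ → + 0) ≡ + 0
Σℤ-zero zero = refl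
Σℤ-zero (suc n) = trans (ℤ.+-identityʳ _) (Σℤ-zero n)

Σℤ-distrib-+ : ∀ n (f g : ℕ → ℤ) → Σℤ n (λ i → f i + g i) ≡ Σℤ n f + Σℤ n g
Σℤ-distrib-+ zero f g = refl
Σℤ-distrib-+ (suc n) f g =
  trans (cong (_+ (f n + g n)) (Σℤ-distrib-+ n f g)) (interchange (Σℤ n f) (Σℤ n g) (f n) (g n))
  where
  interchange : ∀ a b c d → (a + b) + (c + d) ≡ (a + c) + (b + d)
  interchange = solve-∀

Σℤ-distrib-- : ∀ n (f g : ℕ → ℤ) → Σℤ n (λ i → f i - g i) ≡ Σℤ n f - Σℤ n g
Σℤ-distrib-- zero f g = refl
Σℤ-distrib-- (suc n) f g =
  trans (cong (_+ (f n - g n)) (Σℤ-distrib-- n f g)) (interchange (Σℤ n f) (Σℤ n g) (f n) (g n))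
  where
  interchange : ∀ a b c d → (a - b) + (c - d) ≡ (a + c) - (b + d)
  interchange = solve-∀

Σℤ-suc : ∀ n (f : ℕ → ℤ) → Σℤ (suc n) f ≡ f 0 + Σℤ n (f ∘ suc)
Σℤ-suc zero f = trans (ℤ.+-identityˡ (f 0)) (sym (ℤ.+-identityʳ (f 0)))
Σℤ-suc (suc n) f = trans (cong (_+ f (suc n)) (Σℤ-suc n f)) (ℤ.+-assoc (f 0) _ _)

Σℤ-∑-comm : ∀ n {m} (F : ℕ → Fin m → ℤ) →
            Σℤ n (λ i → ∑[ j < m ] F i j) ≡ ∑[ j < m ] Σℤ n (λ i → F i j)
Σℤ-∑-comm zero {m} F = sym (sum-replicate-zero m)
Σℤ-∑-comm (suc n) F = trans (cong (_+ sum (F n)) (Σℤ-∑-comm n F)) (sym (∑-distrib-+ _ (F n)))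

Σℤ-vanishing-tail : ∀ {N M} {f : ℕ → ℤ} → N ≤ M → (∀ m → N ≤ m → m < M → f m ≡ + 0) →
                    Σℤ M f ≡ Σℤ N f
Σℤ-vanishing-tail {M = zero} z≤n _ = refl
Σℤ-vanishing-tail {N} {suc M} {f} N≤1+M vanish with ℕ.m≤n⇒m<n∨m≡n N≤1+M
... | inj₂ refl = refl
... | inj₁ (s≤s N≤M) = begin
    Σℤ M f + f M
  ≡⟨ cong (_+_ (Σℤ M f)) (vanish M N≤M (ℕ.n<1+n M)) ⟩
    Σℤ M f + + 0
  ≡⟨ ℤ.+-identityʳ (Σℤ M f) ⟩
    Σℤ M f
  ≡⟨ Σℤ-vanishing-tail N≤M (λ m N≤m m<M → vanish m N≤m (ℕ.m<n⇒m<1+n m<M)) ⟩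
    Σℤ N f ∎
  where open ≡-Reasoning

Σℤ-*-𝟙< : ∀ {ℓ M} (f : ℕ → ℤ) → ℓ ≤ M → Σℤ M (λ m → f m * + 𝟙 (suc m ≤? ℓ)) ≡ Σℤ ℓ f
Σℤ-*-𝟙< {ℓ} f ℓ≤M = trans (Σℤ-vanishing-tail ℓ≤M excluded) (Σℤ-cong ℓ included)
  where
  excluded : ∀ m → ℓ ≤ m → _ → f m * + 𝟙 (suc m ≤? ℓ) ≡ + 0
  excluded m ℓ≤m _ =
    trans (cong (λ b → f m * + b) (𝟙-no (suc m ≤? ℓ) (ℕ.≤⇒≯ ℓ≤m))) (ℤ.*-zeroʳ (f m))
  included : ∀ m → m < ℓ → f m * + 𝟙 (suc m ≤? ℓ) ≡ f m
  included m m<ℓ =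
    trans (cong (λ b → f m * + b) (𝟙-yes (suc m ≤? ℓ) m<ℓ)) (ℤ.*-identityʳ (f m))

*-distribˡ-offset : ∀ {m} c x (y : Fin m → ℤ) →
                    c * (x + ∑[ j < m ] (y j - x)) ≡ c * x + ∑[ j < m ] (c * y j - c * x)
*-distribˡ-offset c x y =
  trans (ℤ.*-distribˡ-+ c x _) (cong (_+_ (c * x))
    (trans (*-distribˡ-sum c (λ j → y j - x)) (sum-cong-≗ λ j → *-distribˡ-- c (y j) x)))
  where
  *-distribˡ-- : ∀ a b d → a * (b - d) ≡ a * b - a * d
  *-distribˡ-- = solve-∀

pascal : ∀ n k → + (suc n C suc k) ≡ + (n C k) + + (n C suc k)
pascal n k = trans (cong +_ (sym (nCk+nC[k+1]≡[n+1]C[k+1] n k))) (ℤ.pos-+ (n C k) (n C suc k))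

hockey-stick : ∀ {L} k ℓ → ℓ ≤ L →
               Σℤ ℓ (λ m → + ((L ∸ suc m) C k)) ≡ + (L C suc k) - + ((L ∸ ℓ) C suc k)
hockey-stick {L} k zero _ = sym (ℤ.+-inverseʳ (+ (L C suc k)))
hockey-stick {L} k (suc ℓ) ℓ<L = begin
    Σℤ ℓ (λ m → + ((L ∸ suc m) C k)) + + (r C k)
  ≡⟨ cong (λ x → x + + (r C k)) (hockey-stick k ℓ (ℕ.<⇒≤ ℓ<L)) ⟩
    + (L C suc k) - + ((L ∸ ℓ) C suc k) + + (r C k)
  ≡⟨ cong (λ x → + (L C suc k) - + (x C suc k) + + (r C k)) (ℕ.+-∸-assoc 1 ℓ<L) ⟩
    + (L C suc k) - + (suc r C suc k) + + (r C k)
  ≡⟨ cong (λ x → + (L C suc k) - x + + (r C k)) (pascal r k) ⟩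
    + (L C suc k) - (+ (r C k) + + (r C suc k)) + + (r C k)
  ≡⟨ cancel (+ (L C suc k)) (+ (r C k)) (+ (r C suc k)) ⟩
    + (L C suc k) - + (r C suc k) ∎
  where
  open ≡-Reasoning
  r = L ∸ suc ℓ
  cancel : ∀ a b d → a - (b + d) + b ≡ a - d
  cancel = solve-∀

C-vanishes : ∀ {L k m} → k ≤ L → L ∸ k < m → m ≤ L → (L ∸ m) C k ≡ 0
C-vanishes {k = zero} _ L<m m≤L = ⊥-elim (ℕ.<⇒≱ L<m m≤L)
C-vanishes {L} {suc k} {m} k≤L L∸k<m _ = k>n⇒nCk≡0 (ℕ.m<n+o⇒m∸n<o L m L<m+k)
  where
  L<m+k : L < m ℕ.+ suc k
  L<m+k = subst (_< m ℕ.+ suc k) (ℕ.m∸n+n≡m k≤L) (ℕ.+-monoˡ-< (suc k) L∸k<m)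

hWeight : (D k i : ℕ) → ℤ
hWeight D k i = sgn (k ∸ i) * + ((D ∸ i) C (D ∸ k))

-- hVec Γ Γ? D k unfolds to hTransform D k (λ i → + fCount Γ Γ? i); index i carries f_{i-1}.
hTransform : (D k : ℕ) → (ℕ → ℤ) → ℤ
hTransform D k f = Σℤ (suc k) (λ i → hWeight D k i * f i)

hTransform-cong : ∀ D k {f g : ℕ → ℤ} → (∀ i → f i ≡ g i) → hTransform D k f ≡ hTransform D k g
hTransform-cong D k f≡g = Σℤ-cong (suc k) (λ i _ → cong (hWeight D k i *_) (f≡g i))

hTransform-zero : ∀ D k → hTransform D k (λ _ → + 0) ≡ + 0
hTransform-zero D k = trans (Σℤ-cong (suc k) (λ i _ → ℤ.*-zeroʳ (hWeight D k i))) (Σℤ-zero (suc k))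

hTransform-+ : ∀ D k (f g : ℕ → ℤ) →
               hTransform D k (λ i → f i + g i) ≡ hTransform D k f + hTransform D k g
hTransform-+ D k f g =
  trans (Σℤ-cong (suc k) (λ i _ → ℤ.*-distribˡ-+ (hWeight D k i) (f i) (g i)))
        (Σℤ-distrib-+ (suc k) _ _)

hTransform-offset : ∀ D k {m} (a : ℕ → ℤ) (b : Fin m → ℕ → ℤ) →
  hTransform D k (λ i → a i + ∑[ j < m ] (b j i - a i))
    ≡ hTransform D k a + ∑[ j < m ] (hTransform D k (b j) - hTransform D k a)
hTransform-offset D k {m} a b = begin
    Σℤ (suc k) (λ i → w i * (a i + ∑[ j < m ] (b j i - a i)))
  ≡⟨ Σℤ-cong (suc k) (λ i _ → *-distribˡ-offset (w i) (a i) (λ j → b j i)) ⟩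
    Σℤ (suc k) (λ i → w i * a i + ∑[ j < m ] (w i * b j i - w i * a i))
  ≡⟨ Σℤ-distrib-+ (suc k) _ _ ⟩
    hTransform D k a + Σℤ (suc k) (λ i → ∑[ j < m ] (w i * b j i - w i * a i))
  ≡⟨ cong (_+_ (hTransform D k a)) (Σℤ-∑-comm (suc k) (λ i j → w i * b j i - w i * a i)) ⟩
    hTransform D k a + ∑[ j < m ] Σℤ (suc k) (λ i → w i * b j i - w i * a i)
  ≡⟨ cong (_+_ (hTransform D k a))
      (sum-cong-≗ λ j → Σℤ-distrib-- (suc k) (λ i → w i * b j i) (λ i → w i * a i)) ⟩
    hTransform D k a + ∑[ j < m ] (hTransform D k (b j) - hTransform D k a) ∎
  where
  open ≡-Reasoning
  w = hWeight D k

hTransform-simplex : ∀ {ℓ D} k → ℓ ≤ D → k ≤ D →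
                     hTransform D k (λ i → + (ℓ C i)) ≡ sgn k * + ((D ∸ ℓ) C k)
hTransform-simplex {ℓ} {D} zero _ _ = cong (λ x → + 0 + + 1 * + x * + 1) (nCn≡1 D)
hTransform-simplex {zero} {suc D} (suc k) _ (s≤s k≤D) = begin
    hTransform (suc D) (suc k) (λ i → + (0 C i))
  ≡⟨ Σℤ-suc (suc k) _ ⟩
    sgn (suc k) * + (suc D C (D ∸ k)) * + 1 + hTransform D k (λ _ → + 0)
  ≡⟨ cong₂ _+_ (ℤ.*-identityʳ (sgn (suc k) * + (suc D C (D ∸ k)))) (hTransform-zero D k) ⟩
    sgn (suc k) * + (suc D C (D ∸ k)) + + 0
  ≡⟨ ℤ.+-identityʳ (sgn (suc k) * + (suc D C (D ∸ k))) ⟩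
    sgn (suc k) * + (suc D C (D ∸ k))
  ≡⟨ cong (λ x → sgn (suc k) * + x) (sym (nCk≡nC[n∸k] (s≤s k≤D))) ⟩
    sgn (suc k) * + (suc D C suc k) ∎
  where open ≡-Reasoning
hTransform-simplex {suc ℓ} {suc D} (suc k) (s≤s ℓ≤D) (s≤s k≤D) = begin
    hTransform (suc D) (suc k) (λ i → + (suc ℓ C i))
  ≡⟨ hTransform-cong (suc D) (suc k) pascal-shifted ⟩
    hTransform (suc D) (suc k) (λ i → + (ℓ C i) + shifted i)
  ≡⟨ hTransform-+ (suc D) (suc k) (λ i → + (ℓ C i)) shifted ⟩
    hTransform (suc D) (suc k) (λ i → + (ℓ C i)) + hTransform (suc D) (suc k) shifted
  ≡⟨ cong₂ _+_ (hTransform-simplex (suc k) (ℕ.m≤n⇒m≤1+n ℓ≤D) (s≤s k≤D)) shifted-part ⟩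
    sgn (suc k) * + ((suc D ∸ ℓ) C suc k) + sgn k * + (r C k)
  ≡⟨ cong (λ x → sgn (suc k) * + (x C suc k) + sgn k * + (r C k)) (ℕ.+-∸-assoc 1 ℓ≤D) ⟩
    - sgn k * + (suc r C suc k) + sgn k * + (r C k)
  ≡⟨ cong (λ x → - sgn k * x + sgn k * + (r C k)) (pascal r k) ⟩
    - sgn k * (+ (r C k) + + (r C suc k)) + sgn k * + (r C k)
  ≡⟨ cancel (sgn k) (+ (r C k)) (+ (r C suc k)) ⟩
    - sgn k * + (r C suc k) ∎
  where
  open ≡-Reasoning
  r = D ∸ ℓ
  shifted : ℕ → ℤ
  shifted zero = + 0
  shifted (suc i) = + (ℓ C i)
  pascal-shifted : ∀ i → + (suc ℓ C i) ≡ + (ℓ C i) + shifted i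
  pascal-shifted zero = refl
  pascal-shifted (suc i) = trans (pascal ℓ i) (ℤ.+-comm (+ (ℓ C i)) (+ (ℓ C suc i)))
  shifted-part : hTransform (suc D) (suc k) shifted ≡ sgn k * + (r C k)
  shifted-part = begin
      hTransform (suc D) (suc k) shifted
    ≡⟨ Σℤ-suc (suc k) _ ⟩
      - sgn k * + (suc D C (D ∸ k)) * + 0 + hTransform D k (λ i → + (ℓ C i))
    ≡⟨ cong (λ x → x + hTransform D k (λ i → + (ℓ C i))) (ℤ.*-zeroʳ (hWeight (suc D) (suc k) 0)) ⟩
      + 0 + hTransform D k (λ i → + (ℓ C i))
    ≡⟨ ℤ.+-identityˡ _ ⟩
      hTransform D k (λ i → + (ℓ C i))
    ≡⟨ hTransform-simplex k ℓ≤D k≤D ⟩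
      sgn k * + (r C k) ∎
  cancel : ∀ s a b → - s * (a + b) + s * a ≡ - s * b
  cancel = solve-∀

hVec-unionOfSimplices : ∀ {n a} (W : Fin (suc a) → Subset n) → PairwiseDisjoint W →
  ∀ {D} k → k ≤ D → (∀ j → ∣ W j ∣ ≤ D) →
  hVec (unionOfSimplices W) (unionOfSimplices? W) D k
    ≡ sgn k * + (D C k) + ∑[ j < suc a ] (sgn k * + ((D ∸ ∣ W j ∣) C k) - sgn k * + (D C k))
hVec-unionOfSimplices {a = a} W disjoint {D} k k≤D W≤D = begin
    hTransform D k (λ i → + fCount (unionOfSimplices W) (unionOfSimplices? W) i)
  ≡⟨ hTransform-cong D k (fCount-unionOfSimplices W disjoint) ⟩
    hTransform D k (λ i → + (0 C i) + ∑[ j < suc a ] (+ (∣ W j ∣ C i) - + (0 C i)))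
  ≡⟨ hTransform-offset D k (λ i → + (0 C i)) (λ j i → + (∣ W j ∣ C i)) ⟩
    hTransform D k (λ i → + (0 C i))
      + ∑[ j < suc a ] (hTransform D k (λ i → + (∣ W j ∣ C i)) - hTransform D k (λ i → + (0 C i)))
  ≡⟨ cong₂ _+_ empty-simplex
      (sum-cong-≗ (λ j → cong₂ _-_ (hTransform-simplex k (W≤D j) k≤D) empty-simplex)) ⟩
    sgn k * + (D C k) + ∑[ j < suc a ] (sgn k * + ((D ∸ ∣ W j ∣) C k) - sgn k * + (D C k)) ∎
  where
  open ≡-Reasoning
  empty-simplex : hTransform D k (λ i → + (0 C i)) ≡ sgn k * + (D C k)
  empty-simplex = hTransform-simplex k z≤n k≤D

conj≡∑𝟙 : ∀ {α} (λ' : Fin α → ℕ) m → + conj λ' m ≡ ∑[ j < α ] (+ 𝟙 (m ≤? λ' j))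
conj≡∑𝟙 {α} λ' m = trans
  (cong +_ (trans (length-filter≡sum-𝟙 (λ j → m ≤? λ' j) (allFin α))
                  (sum-map-tabulate (λ j → 𝟙 (m ≤? λ' j)) (λ j → j))))
  (pos-sum (λ j → 𝟙 (m ≤? λ' j)))

weighted-conj-sum : ∀ {α} (λ' : Fin α → ℕ) {L} k → suc k ≤ L → (∀ j → λ' j ≤ L) →
  Σℤ (suc (L ∸ suc k)) (λ m → + ((L ∸ suc m) C k) * (+ conj λ' (suc m) - + 1))
    ≡ ∑[ j < α ] (+ (L C suc k) - + ((L ∸ λ' j) C suc k)) - + (L C suc k)
weighted-conj-sum {α} λ' {suc L′} k (s≤s k≤L′) λ≤L′ = begin
    Σℤ N (λ m → c m * (+ conj λ' (suc m) - + 1))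
  ≡⟨ Σℤ-cong N (λ m _ → split m) ⟩
    Σℤ N (λ m → ∑[ j < α ] (c m * + 𝟙 (suc m ≤? λ' j)) - c m * + 1)
  ≡⟨ Σℤ-distrib-- N (λ m → ∑[ j < α ] (c m * + 𝟙 (suc m ≤? λ' j))) (λ m → c m * + 1) ⟩
    Σℤ N (λ m → ∑[ j < α ] (c m * + 𝟙 (suc m ≤? λ' j))) - Σℤ N (λ m → c m * + 1)
  ≡⟨ cong₂ _-_ (Σℤ-∑-comm N (λ m j → c m * + 𝟙 (suc m ≤? λ' j)))
               (truncate (λ _ → + 1)) ⟩
    ∑[ j < α ] Σℤ N (λ m → c m * + 𝟙 (suc m ≤? λ' j)) - Σℤ (suc L′) (λ m → c m * + 1)
  ≡⟨ cong₂ _-_ (sum-cong-≗ part) whole ⟩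
    ∑[ j < α ] (A - + ((suc L′ ∸ λ' j) C suc k)) - A ∎
  where
  open ≡-Reasoning
  N = suc (L′ ∸ k)
  A = + (suc L′ C suc k)
  c : ℕ → ℤ
  c m = + ((L′ ∸ m) C k)
  split : ∀ m → c m * (+ conj λ' (suc m) - + 1)
                ≡ ∑[ j < α ] (c m * + 𝟙 (suc m ≤? λ' j)) - c m * + 1
  split m = begin
      c m * (+ conj λ' (suc m) - + 1)
    ≡⟨ cong (λ x → c m * (x - + 1)) (conj≡∑𝟙 λ' (suc m)) ⟩
      c m * (∑[ j < α ] (+ 𝟙 (suc m ≤? λ' j)) - + 1)
    ≡⟨ *-distribˡ-- (c m) _ (+ 1) ⟩
      c m * ∑[ j < α ] (+ 𝟙 (suc m ≤? λ' j)) - c m * + 1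
    ≡⟨ cong (_- c m * + 1) (*-distribˡ-sum (c m) (λ j → + 𝟙 (suc m ≤? λ' j))) ⟩
      ∑[ j < α ] (c m * + 𝟙 (suc m ≤? λ' j)) - c m * + 1 ∎
    where
    *-distribˡ-- : ∀ a b d → a * (b - d) ≡ a * b - a * d
    *-distribˡ-- = solve-∀
  truncate : ∀ g → Σℤ N (λ m → c m * g m) ≡ Σℤ (suc L′) (λ m → c m * g m)
  truncate g = sym (Σℤ-vanishing-tail (s≤s (ℕ.m∸n≤m L′ k))
    (λ m N≤m m<1+L′ → cong (λ x → + x * g m) (C-vanishes k≤L′ N≤m (ℕ.≤-pred m<1+L′))))
  part : ∀ j → Σℤ N (λ m → c m * + 𝟙 (suc m ≤? λ' j)) ≡ A - + ((suc L′ ∸ λ' j) C suc k)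
  part j = trans (truncate _) (trans (Σℤ-*-𝟙< c (λ≤L′ j)) (hockey-stick k (λ' j) (λ≤L′ j)))
  whole : Σℤ (suc L′) (λ m → c m * + 1) ≡ A
  whole = begin
      Σℤ (suc L′) (λ m → c m * + 1)
    ≡⟨ Σℤ-cong (suc L′) (λ m _ → ℤ.*-identityʳ (c m)) ⟩
      Σℤ (suc L′) c
    ≡⟨ hockey-stick k (suc L′) ℕ.≤-refl ⟩
      A - + ((L′ ∸ L′) C suc k)
    ≡⟨ cong (λ x → A - + (x C suc k)) (ℕ.n∸n≡0 L′) ⟩
      A - + 0
    ≡⟨ ℤ.+-identityʳ A ⟩
      A ∎

sgn-flip : ∀ k x → sgn k * (sgn (suc k) * x) ≡ - x
sgn-flip zero x = negate x
  where
  negate : ∀ y → + 1 * (- + 1 * y) ≡ - y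
  negate = solve-∀
sgn-flip (suc k) x = trans (double-negation (sgn k) x) (sgn-flip k x)
  where
  double-negation : ∀ s y → - s * (- - s * y) ≡ s * (- s * y)
  double-negation = solve-∀

sgn-*-offset : ∀ k {m} x (y : Fin m → ℤ) →
  sgn k * (sgn (suc k) * x + ∑[ j < m ] (sgn (suc k) * y j - sgn (suc k) * x)) ≡ ∑[ j < m ] (x - y j) - x
sgn-*-offset k {m} x y = begin
    sgn k * (sgn (suc k) * x + ∑[ j < m ] (sgn (suc k) * y j - sgn (suc k) * x))
  ≡⟨ *-distribˡ-offset (sgn k) (sgn (suc k) * x) (λ j → sgn (suc k) * y j) ⟩
    sgn k * (sgn (suc k) * x) + ∑[ j < m ] (sgn k * (sgn (suc k) * y j) - sgn k * (sgn (suc k) * x))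
  ≡⟨ cong₂ _+_ (sgn-flip k x) (sum-cong-≗ (λ j → cong₂ _-_ (sgn-flip k (y j)) (sgn-flip k x))) ⟩
    - x + ∑[ j < m ] (- y j - - x)
  ≡⟨ cong (_+_ (- x)) (sum-cong-≗ (λ j → neg-swap (y j) x)) ⟩
    - x + ∑[ j < m ] (x - y j)
  ≡⟨ ℤ.+-comm (- x) _ ⟩
    ∑[ j < m ] (x - y j) - x ∎
  where
  open ≡-Reasoning
  neg-swap : ∀ a b → - a - - b ≡ b - a
  neg-swap = solve-∀

signed-hVec-unionOfSimplices : ∀ {n a} (W : Fin (suc a) → Subset n) → PairwiseDisjoint W →
  ∀ {D} k → suc k ≤ D → (∀ j → ∣ W j ∣ ≤ D) →
  sgn k * hVec (unionOfSimplices W) (unionOfSimplices? W) D (suc k)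
    ≡ ∑[ j < suc a ] (+ (D C suc k) - + ((D ∸ ∣ W j ∣) C suc k)) - + (D C suc k)
signed-hVec-unionOfSimplices W disjoint {D} k k<D W≤D =
  trans (cong (sgn k *_) (hVec-unionOfSimplices W disjoint (suc k) k<D W≤D))
        (sgn-*-offset k (+ (D C suc k)) (λ j → + ((D ∸ ∣ W j ∣) C suc k)))

proposition2p3 : (a : ℕ) (λ' : Fin (suc a) → ℕ)
    → (∀ i j → i ≤ᶠ j → λ' j ≤ λ' i)
    → (∀ i → 1 ≤ λ' i)
    → (n : ℕ) (W : Fin (suc a) → Subset n)
    → (∀ i j → i ≢ j → Empty (W i ∩ W j))
    → (∀ i → ∣ W i ∣ ≡ λ' i)
    → (hVec (unionOfSimplices W) (unionOfSimplices? W) (λ' zero) 0 ≡ + 1)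
    × (∀ k → 1 ≤ k → k ≤ λ' zero
    → sgn (k ∸ 1) * hVec (unionOfSimplices W) (unionOfSimplices? W) (λ' zero) k
    ≡ Σℤ (suc (λ' zero ∸ k))
    (λ m' → (+ ((λ' zero ∸ suc m') C (k ∸ 1))) * (+ conj λ' (suc m') - + 1)))
proposition2p3 a λ' decreasing _ n W disjoint size = h₀≡1 , hₖ-formula
  where
  L = λ' zero
  λ≤L : ∀ j → λ' j ≤ L
  λ≤L j = decreasing zero j z≤n
  W≤L : ∀ j → ∣ W j ∣ ≤ L
  W≤L j = subst (_≤ L) (sym (size j)) (λ≤L j)
  h₀≡1 : hVec (unionOfSimplices W) (unionOfSimplices? W) L 0 ≡ + 1
  h₀≡1 = trans (hVec-unionOfSimplices W disjoint 0 z≤n W≤L)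
               (cong (_+_ (+ 1)) (sum-replicate-zero (suc a)))
  hₖ-formula : ∀ k → 1 ≤ k → k ≤ L
    → sgn (k ∸ 1) * hVec (unionOfSimplices W) (unionOfSimplices? W) L k
      ≡ Σℤ (suc (L ∸ k)) (λ m → + ((L ∸ suc m) C (k ∸ 1)) * (+ conj λ' (suc m) - + 1))
  hₖ-formula (suc k) _ k≤L = begin
      sgn k * hVec (unionOfSimplices W) (unionOfSimplices? W) L (suc k)
    ≡⟨ signed-hVec-unionOfSimplices W disjoint k k≤L W≤L ⟩
      ∑[ j < suc a ] (A - B (∣ W j ∣)) - A
    ≡⟨ cong (_- A) (sum-cong-≗ (λ j → cong (λ ℓ → A - B ℓ) (size j))) ⟩
      ∑[ j < suc a ] (A - B (λ' j)) - A
    ≡⟨ sym (weighted-conj-sum λ' k k≤L λ≤L) ⟩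
      Σℤ (suc (L ∸ suc k)) (λ m → + ((L ∸ suc m) C k) * (+ conj λ' (suc m) - + 1)) ∎
    where
    open ≡-Reasoning
    A = + (L C suc k)
    B : ℕ → ℤ
    B ℓ = + ((L ∸ ℓ) C suc k)
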